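{- Let $n \geq 4$ be an integer. Let $G_{n-1,2}$ be the bipartite graph whose two vertex classes are $\binom{[n]}{n-1}$ and $\binom{[n]}{2}$, where an $(n-1)$-element set $S$ and a $2$-element set $T$ are adjacent if and only if $T \subset S$. Then the domination number of $G_{n-1,2}$ equals $3$.
   Context: $[n] = \{1,2,\dots,n\}$, and $\binom{[n]}{m}$ denotes the family of all $m$-element subsets of $[n]$. For integers $n > k > l \geq 1$, $G_{k,l}$ denotes the bipartite graph with vertex classes $\binom{[n]}{k}$ and $\binom{[n]}{l}$, in which $S \in \binom{[n]}{k}$ and $T \in \binom{[n]}{l}$ are adjacent iff $T \subset S$; there are no other edges. A dominating set of a graph is a set $D$ of vertices such that every vertex not in $D$ has a neighbour in $D$; the domination number $\gamma(G)$ is the minimum size of a dominating set of $G$. -}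

module Defs where

open import Data.Nat using (ℕ; _≤_)
open import Data.Fin.Subset using (Subset; ∣_∣; _⊆_)
open import Data.Sum using (_⊎_; inj₁; inj₂)
open import Data.Product using (Σ; _×_; _,_; ∃-syntax)
open import Data.List using (List; length)
open import Data.List.Membership.Propositional using (_∈_)
open import Data.List.Relation.Unary.Unique.Propositional using (Unique)
open import Data.Empty using (⊥)
open import Relation.Binary.PropositionalEquality using (_≡_)

_choose_ : ℕ → ℕ → Set
n choose m = Σ (Subset n) (λ A → ∣ A ∣ ≡ m)

record Graph : Set₁ where
  field
    V   : Set
    Adj : V → V → Set
open Graph public

Gkl : (n k l : ℕ) → Graph
Gkl n k l = record { V = (n choose k) ⊎ (n choose l) ; Adj = adj }
  where
    adj : (n choose k) ⊎ (n choose l) → (n choose k) ⊎ (n choose l) → Set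
    adj (inj₁ (S , _)) (inj₂ (T , _)) = T ⊆ S
    adj (inj₂ (T , _)) (inj₁ (S , _)) = T ⊆ S
    adj (inj₁ _) (inj₁ _) = ⊥
    adj (inj₂ _) (inj₂ _) = ⊥

-- A finite vertex set D (a duplicate-free list) is dominating if every vertex
-- not in D has a neighbour in D.  (Stated equivalently without decidability of
-- membership: every vertex is in D or has a neighbour in D.)
IsDominating : (Γ : Graph) → List (V Γ) → Set
IsDominating Γ D = (v : V Γ) → (v ∈ D) ⊎ (∃[ u ] (u ∈ D × Adj Γ v u))

DominationNumberIs : Graph → ℕ → Set
DominationNumberIs Γ m =
  (∃[ D ] (Unique D × IsDominating Γ D × length D ≡ m))
  × ((D : List (V Γ)) → Unique D → IsDominating Γ D → m ≤ length D)

-- The dominating set is {[n]∖{0}, [n]∖{1}, {0,1}}: an (n−1)-set missing 0 or 1 is one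
-- of the two co-points, and otherwise it contains {0,1}; a 2-set missing 0 or 1 lies in
-- the corresponding co-point, and otherwise it is {0,1}.  Conversely, both classes are
-- independent, so two vertices from the same class miss one of three vertices of that
-- class; and a pair {S, T} from different classes misses the co-point [n]∖{y} of some
-- y ∈ T with [n]∖{y} ≠ S, which exists because T has two elements.
module Submission where

open import Defs
open import Data.Nat using (ℕ; suc; _≤_; _<_; _∸_; s≤s; z≤n)
open import Data.Nat.Properties using (≤-reflexive; <⇒≱; ≡-irrelevant)
open import Data.Fin using (Fin; zero; suc; _↑ˡ_)
open import Data.Fin.Properties using (↑ˡ-injective; suc-injective)
open import Data.Fin.Subset
  using (Subset; ∣_∣; _⊆_; Nonempty; ∁; ⁅_⁆; inside; outside)
  renaming (_∈_ to _∈ₛ_; _∉_ to _∉ₛ_)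
open import Data.Fin.Subset.Properties
  using ( _∈?_; ⊆-antisym; p⊂q⇒∣p∣<∣q∣; ∣∁p∣≡n∸∣p∣; ∣⁅x⁆∣≡1; x∈⁅x⁆; x∈⁅y⁆⇒x≡y
        ; x≢y⇒x∉⁅y⁆; x∈p⇒x∉∁p; x∉∁p⇒x∈p; x∉p⇒x∈∁p; drop-there)
open import Data.Vec using (_∷_; here; there)
open import Data.Vec.Properties using (≡-dec)
open import Data.Bool.Properties using () renaming (_≟_ to _≟ᵇ_)
open import Data.List using (List; []; _∷_; length)
open import Data.List.Membership.Propositional using (_∈_; _∉_)
open import Data.List.Relation.Binary.Subset.Propositional using () renaming (_⊆_ to _⊆ₗ_)
open import Data.List.Relation.Unary.Any using (here; there)
open import Data.List.Relation.Unary.Unique.Propositional using (Unique)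
open import Data.List.Relation.Unary.All using ([]; _∷_)
open import Data.List.Relation.Unary.AllPairs using ([]; _∷_)
open import Data.Sum using (inj₁; inj₂)
import Data.Sum as Sum
open import Data.Product using (_×_; _,_; proj₁; ∃-syntax; ∃₂)
import Data.Product as Product
open import Data.Empty using (⊥-elim)
open import Function using (_∘_; id)
open import Function.Definitions using (Injective)
open import Relation.Nullary using (¬_; yes; no)
open import Relation.Binary.Definitions using (DecidableEquality)
open import Relation.Binary.PropositionalEquality using (_≡_; _≢_; refl; sym; trans; cong; subst)

module _ {a} {A : Set a} (_≟_ : DecidableEquality A)
         (f : Fin 3 → A) (f-inj : Injective _≡_ _≡_ f) where

  tail-avoid-one : ∀ Z → ∃[ i ] (f (suc i) ≢ f zero × f (suc i) ≢ Z)
  tail-avoid-one Z with f (suc zero) ≟ Z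
  ... | no f₁≢Z  = zero , (λ ()) ∘ f-inj , f₁≢Z
  ... | yes refl = suc zero , (λ ()) ∘ f-inj , (λ ()) ∘ f-inj

  three-avoid-two : ∀ X Y → ∃[ i ] (f i ≢ X × f i ≢ Y)
  three-avoid-two X Y with f zero ≟ X | f zero ≟ Y
  ... | no f₀≢X | no f₀≢Y  = zero , f₀≢X , f₀≢Y
  ... | yes refl | _       = Product.map suc id (tail-avoid-one Y)
  ... | no _     | yes refl = Product.map suc Product.swap (tail-avoid-one X)

private
  variable
    n : ℕ

_≟ₛ_ : DecidableEquality (Subset n)
_≟ₛ_ = ≡-dec _≟ᵇ_

⊆-∣∣-antisym : {p q : Subset n} → p ⊆ q → ∣ q ∣ ≤ ∣ p ∣ → p ≡ q
⊆-∣∣-antisym {p = p} {q} p⊆q ∣q∣≤∣p∣ = ⊆-antisym p⊆q q⊆p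
  where
  q⊆p : q ⊆ p
  q⊆p {x} x∈q with x ∈? p
  ... | yes x∈p = x∈p
  ... | no x∉p  = ⊥-elim (<⇒≱ (p⊂q⇒∣p∣<∣q∣ (p⊆q , x , x∈q , x∉p)) ∣q∣≤∣p∣)

0<∣p∣⇒Nonempty : {p : Subset n} → 0 < ∣ p ∣ → Nonempty p
0<∣p∣⇒Nonempty {p = outside ∷ p} 0<∣p∣ = Product.map suc there (0<∣p∣⇒Nonempty 0<∣p∣)
0<∣p∣⇒Nonempty {p = inside ∷ p}  _      = zero , here

1<∣p∣⇒two-elements : {p : Subset n} → 1 < ∣ p ∣ →
                     ∃₂ λ y z → y ≢ z × y ∈ₛ p × z ∈ₛ p
1<∣p∣⇒two-elements {p = outside ∷ p} 1<∣p∣ with 1<∣p∣⇒two-elements 1<∣p∣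
... | y , z , y≢z , y∈p , z∈p = suc y , suc z , y≢z ∘ suc-injective , there y∈p , there z∈p
1<∣p∣⇒two-elements {p = inside ∷ p} (s≤s 0<∣p∣) with 0<∣p∣⇒Nonempty 0<∣p∣
... | z , z∈p = zero , suc z , (λ ()) , here , there z∈p

∣∁⁅x⁆∣≡n∸1 : ∀ {n} (x : Fin n) → ∣ ∁ ⁅ x ⁆ ∣ ≡ n ∸ 1
∣∁⁅x⁆∣≡n∸1 {n} x = trans (∣∁p∣≡n∸∣p∣ ⁅ x ⁆) (cong (n ∸_) (∣⁅x⁆∣≡1 x))

∁⁅⁆-injective : Injective _≡_ _≡_ (λ (x : Fin n) → ∁ ⁅ x ⁆)
∁⁅⁆-injective {x = x} {y} eq =
  x∈⁅y⁆⇒x≡y y (x∉∁p⇒x∈p (subst (x ∉ₛ_) eq (x∈p⇒x∉∁p (x∈⁅x⁆ x))))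

1<∣p∣⇒∃∁⁅⁆≢ : {p : Subset n} (q : Subset n) → 1 < ∣ p ∣ → ∃[ y ] (y ∈ₛ p × ∁ ⁅ y ⁆ ≢ q)
1<∣p∣⇒∃∁⁅⁆≢ q 1<∣p∣ with 1<∣p∣⇒two-elements 1<∣p∣
... | y , z , y≢z , y∈p , z∈p with ∁ ⁅ y ⁆ ≟ₛ q
...   | no ∁⁅y⁆≢q = y , y∈p , ∁⁅y⁆≢q
...   | yes refl  = z , z∈p , y≢z ∘ sym ∘ ∁⁅⁆-injective

x∉p⇒p⊆∁⁅x⁆ : {x : Fin n} {p : Subset n} → x ∉ₛ p → p ⊆ ∁ ⁅ x ⁆
x∉p⇒p⊆∁⁅x⁆ x∉p y∈p = x∉p⇒x∈∁p (x≢y⇒x∉⁅y⁆ λ { refl → x∉p y∈p })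

x∉p⇒p≡∁⁅x⁆ : {x : Fin n} {p : Subset n} → x ∉ₛ p → ∣ p ∣ ≡ n ∸ 1 → p ≡ ∁ ⁅ x ⁆
x∉p⇒p≡∁⁅x⁆ {x = x} x∉p ∣p∣≡n∸1 =
  ⊆-∣∣-antisym (x∉p⇒p⊆∁⁅x⁆ x∉p) (≤-reflexive (trans (∣∁⁅x⁆∣≡n∸1 x) (sym ∣p∣≡n∸1)))

⁅0,suc_⁆ : ∀ {n} → Fin n → Subset (suc n)
⁅0,suc i ⁆ = inside ∷ ⁅ i ⁆

∣⁅0,suc⁆∣≡2 : (i : Fin n) → ∣ ⁅0,suc i ⁆ ∣ ≡ 2
∣⁅0,suc⁆∣≡2 i = cong suc (∣⁅x⁆∣≡1 i)

⁅0,suc⁆-injective : Injective _≡_ _≡_ (λ (i : Fin n) → ⁅0,suc i ⁆)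
⁅0,suc⁆-injective {x = i} {j} eq =
  x∈⁅y⁆⇒x≡y j (drop-there (subst (suc i ∈ₛ_) eq (there (x∈⁅x⁆ i))))

⁅0,suc⁆⊆ : {i : Fin n} {p : Subset (suc n)} → zero ∈ₛ p → suc i ∈ₛ p → ⁅0,suc i ⁆ ⊆ p
⁅0,suc⁆⊆ 0∈p _    here = 0∈p
⁅0,suc⁆⊆ _   i∈p (there y∈⁅i⁆) = subst (λ y → suc y ∈ₛ _) (sym (x∈⁅y⁆⇒x≡y _ y∈⁅i⁆)) i∈p

∣p∣≡2⇒p≡⁅0,suc⁆ : {i : Fin n} {p : Subset (suc n)} → zero ∈ₛ p → suc i ∈ₛ p →
                  ∣ p ∣ ≡ 2 → p ≡ ⁅0,suc i ⁆
∣p∣≡2⇒p≡⁅0,suc⁆ {i = i} 0∈p i∈p ∣p∣≡2 =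
  sym (⊆-∣∣-antisym (⁅0,suc⁆⊆ 0∈p i∈p) (≤-reflexive (trans ∣p∣≡2 (sym (∣⁅0,suc⁆∣≡2 i)))))

IsDominating-mono : ∀ {Γ} {D D′ : List (V Γ)} → D ⊆ₗ D′ → IsDominating Γ D → IsDominating Γ D′
IsDominating-mono D⊆D′ dom v = Sum.map D⊆D′ (Product.map₂ (Product.map₁ D⊆D′)) (dom v)

undominated⇒¬IsDominating : ∀ {Γ} {D : List (V Γ)} (v : V Γ) → v ∉ D →
                            (∀ {u} → u ∈ D → ¬ Adj Γ v u) → ¬ IsDominating Γ D
undominated⇒¬IsDominating v v∉D ¬adj dom with dom v
... | inj₁ v∈D              = v∉D v∈D
... | inj₂ (u , u∈D , v~u) = ¬adj u∈D v~u

-- Indexing by m = n − 1 makes n ∸ 1 compute to m.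
G : ℕ → Graph
G m = Gkl (suc m) m 2

subset : ∀ {m} → V (G m) → Subset (suc m)
subset (inj₁ (S , _)) = S
subset (inj₂ (T , _)) = T

∉-pair : ∀ {m} {v u w : V (G m)} → subset v ≢ subset u → subset v ≢ subset w → v ∉ u ∷ w ∷ []
∉-pair v≢u _   (here v≡u)         = v≢u (cong subset v≡u)
∉-pair _   v≢w (there (here v≡w)) = v≢w (cong subset v≡w)

proj₁-injective : ∀ {n k} {P Q : n choose k} → proj₁ P ≡ proj₁ Q → P ≡ Q
proj₁-injective {P = S , s} {.S , t} refl = cong (S ,_) (≡-irrelevant s t)

∁⁅_⁆ᵥ : ∀ {m} → Fin (suc m) → V (G m)
∁⁅ x ⁆ᵥ = inj₁ (∁ ⁅ x ⁆ , ∣∁⁅x⁆∣≡n∸1 x)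

⁅0,suc_⁆ᵥ : ∀ {m} → Fin m → V (G m)
⁅0,suc i ⁆ᵥ = inj₂ (⁅0,suc i ⁆ , ∣⁅0,suc⁆∣≡2 i)

module _ {m : ℕ} (i : Fin m) where

  co-points-and-pair : List (V (G m))
  co-points-and-pair = ∁⁅ zero ⁆ᵥ ∷ ∁⁅ suc i ⁆ᵥ ∷ ⁅0,suc i ⁆ᵥ ∷ []

  co-points-and-pair-unique : Unique co-points-and-pair
  co-points-and-pair-unique =
    ((λ eq → 0≢suc (∁⁅⁆-injective (cong subset eq))) ∷ (λ ()) ∷ []) ∷ ((λ ()) ∷ []) ∷ [] ∷ []
    where
    0≢suc : zero ≢ suc i
    0≢suc ()

  co-points-and-pair-dominating : IsDominating (G m) co-points-and-pair
  co-points-and-pair-dominating (inj₁ (S , s)) with zero ∈? S | suc i ∈? S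
  ... | no 0∉S | _ = inj₁ (here (cong inj₁ (proj₁-injective (x∉p⇒p≡∁⁅x⁆ 0∉S s))))
  ... | yes _  | no i∉S = inj₁ (there (here (cong inj₁ (proj₁-injective (x∉p⇒p≡∁⁅x⁆ i∉S s)))))
  ... | yes 0∈S | yes i∈S = inj₂ (_ , there (there (here refl)) , ⁅0,suc⁆⊆ 0∈S i∈S)
  co-points-and-pair-dominating (inj₂ (T , t)) with zero ∈? T | suc i ∈? T
  ... | no 0∉T | _ = inj₂ (_ , here refl , x∉p⇒p⊆∁⁅x⁆ 0∉T)
  ... | yes _  | no i∉T = inj₂ (_ , there (here refl) , x∉p⇒p⊆∁⁅x⁆ i∉T)
  ... | yes 0∈T | yes i∈T =
    inj₁ (there (there (here (cong inj₂ (proj₁-injective (∣p∣≡2⇒p≡⁅0,suc⁆ 0∈T i∈T t))))))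

module _ {m : ℕ} (ι : Fin 3 → Fin m) (ι-inj : Injective _≡_ _≡_ ι) where

  pair-¬IsDominating : (u w : V (G m)) → ¬ IsDominating (G m) (u ∷ w ∷ [])
  pair-¬IsDominating (inj₁ (S , _)) (inj₁ (S′ , _))
    with three-avoid-two _≟ₛ_ (λ j → ∁ ⁅ suc (ι j) ⁆) (ι-inj ∘ suc-injective ∘ ∁⁅⁆-injective) S S′
  ... | j , ≢S , ≢S′ = undominated⇒¬IsDominating ∁⁅ suc (ι j) ⁆ᵥ (∉-pair ≢S ≢S′)
                         λ { (here refl) () ; (there (here refl)) () }
  pair-¬IsDominating (inj₂ (T , _)) (inj₂ (T′ , _))
    with three-avoid-two _≟ₛ_ (λ j → ⁅0,suc ι j ⁆) (ι-inj ∘ ⁅0,suc⁆-injective) T T′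
  ... | j , ≢T , ≢T′ = undominated⇒¬IsDominating ⁅0,suc ι j ⁆ᵥ (∉-pair ≢T ≢T′)
                         λ { (here refl) () ; (there (here refl)) () }
  pair-¬IsDominating (inj₁ (S , _)) (inj₂ (T , t))
    with 1<∣p∣⇒∃∁⁅⁆≢ S (≤-reflexive (sym t))
  ... | y , y∈T , ≢S = undominated⇒¬IsDominating ∁⁅ y ⁆ᵥ
                         (λ { (here eq) → ≢S (cong subset eq) ; (there (here ())) })
                         λ { (here refl) ()
                           ; (there (here refl)) T⊆∁⁅y⁆ → x∈p⇒x∉∁p (x∈⁅x⁆ y) (T⊆∁⁅y⁆ y∈T) }
  pair-¬IsDominating (inj₂ T) (inj₁ S) =
    pair-¬IsDominating (inj₁ S) (inj₂ T) ∘ IsDominating-mono λ where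
      (here eq)         → there (here eq)
      (there (here eq)) → here eq

  IsDominating⇒3≤length : (D : List (V (G m))) → IsDominating (G m) D → 3 ≤ length D
  IsDominating⇒3≤length (_ ∷ _ ∷ _ ∷ _) _ = s≤s (s≤s (s≤s z≤n))
  IsDominating⇒3≤length [] dom =
    ⊥-elim (pair-¬IsDominating ∁⁅ zero ⁆ᵥ ∁⁅ zero ⁆ᵥ (IsDominating-mono (λ ()) dom))
  IsDominating⇒3≤length (u ∷ []) dom =
    ⊥-elim (pair-¬IsDominating u u (IsDominating-mono (λ { (here eq) → here eq }) dom))
  IsDominating⇒3≤length (u ∷ w ∷ []) dom = ⊥-elim (pair-¬IsDominating u w dom)

theorem2 : (n : ℕ) → 4 ≤ n → DominationNumberIs (Gkl n (n ∸ 1) 2) 3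
theorem2 .(suc (suc (suc (suc k)))) (s≤s (s≤s (s≤s (s≤s {n = k} z≤n)))) =
    ( co-points-and-pair zero
    , co-points-and-pair-unique zero
    , co-points-and-pair-dominating zero
    , refl )
  , λ D _ → IsDominating⇒3≤length (_↑ˡ k) (λ {i} {j} → ↑ˡ-injective k i j) D
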